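{- Let $m\ge 2$ and $k\in\mathbb{N}$, and let $n\ge 0$ satisfy $n\equiv i\pmod m$ with $i\in\{0,\ldots,m-1\}$. Then \[ a_m(k,n)\le\left(\frac{m}{m-1}\right)^{\lfloor (k-i)/m\rfloor}\prod_{j=0}^{\lfloor (k-i)/m\rfloor-1}(k-i-jm). \] In particular, for each fixed $k$ the sequence $(a_m(k,n))_{n=0}^{\infty}$ is bounded.
   Context: For integers $m\ge 2$, $k\ge 0$, $n\ge 0$, $a_m(k,n)$ denotes the number of partitions of $n$ into exactly $k$ parts, each part being a power of $m$ (i.e. $a_m(k,n)$ is the coefficient of $t^k$ in $p_m(n,t)$, where $\prod_{j\ge0}\frac{1}{1-tq^{m^j}}=\sum_n p_m(n,t)q^n$). An empty product equals $1$. -}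

module Defs where

open import Data.Nat using (ℕ; zero; suc; _+_; _*_; _∸_; _^_; _≤_)
open import Data.List using (List; length)
open import Data.Nat.ListAction using (sum)
open import Data.List.Relation.Unary.All using (All)
open import Data.List.Relation.Unary.Linked using (Linked)
open import Data.Product using (_×_; ∃-syntax)
open import Relation.Binary.PropositionalEquality using (_≡_)

IsPowerOf : ℕ → ℕ → Set
IsPowerOf m p = ∃[ j ] p ≡ m ^ j

-- A partition of n into exactly k parts, each a power of m, represented
-- canonically as a non-increasing list of its parts.
IsPowPartition : (m k n : ℕ) → List ℕ → Set
IsPowPartition m k n ps =
  Linked (λ a b → b ≤ a) ps × All (IsPowerOf m) ps × length ps ≡ k × sum ps ≡ n

-- prodTerms m c r = ∏_{j=0}^{r-1} (c - j m)   (truncated subtraction; in the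
-- theorem all factors are positive, so ∸ agrees with integer subtraction)
prodTerms : (m c r : ℕ) → ℕ
prodTerms m c zero    = 1
prodTerms m c (suc r) = prodTerms m c r * (c ∸ r * m)

{-# OPTIONS --safe #-}

-- A partition into powers of m either has a part 1, which can be removed, or has all parts
-- divisible by m, which can be divided by m; hence
--   a(k+1, n+1) ≤ a(k, n) + [m ∣ n+1] · a(k+1, (n+1)/m).
-- By strong induction on n this gives a(k, n) ≤ bound (k ∸ n % m), where
--   bound (x+1) = bound x + ⌊x/(m−1)⌋ · bound (x+1−m).
-- When m ∣ n, unfolding the second term along n, n/m, n/m², … produces one term
-- a(k, n/mʲ − 1) ≤ bound (k+1−m) per level.  Since adding a power of m raises the base-m digit
-- sum by at most one, such a term vanishes unless k is at least the digit sum of n/mʲ − 1, and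
-- that digit sum grows by m − 1 per level, so at most ⌊k/(m−1)⌋ of these terms survive.
-- Finally (m−1) · bound (z+m) ≤ m (z+m) · bound z, which iterates to
-- (m−1)^r · bound K ≤ m^r · K (K−m) ⋯ (K−(r−1)m) for r = ⌊K/m⌋.

module Submission where

open import Defs
open import Data.Empty using (⊥-elim)
open import Data.List using (List; []; _∷_; length; map; filter; _∷ʳ_)
open import Data.List.Properties using (length-map; length-++; map-∘; map-id-local)
open import Data.List.Membership.Propositional using (_∈_; _∉_)
open import Data.List.Relation.Unary.Any using (here; there)
open import Data.List.Relation.Unary.All as All using (All; []; _∷_)
import Data.List.Relation.Unary.All.Properties as All
open import Data.List.Relation.Unary.AllPairs using ([]; _∷_)
open import Data.List.Relation.Unary.Linked as Linked using (Linked; []; [-]; _∷_)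
import Data.List.Relation.Unary.Linked.Properties as Linked
open import Data.List.Relation.Unary.Unique.Propositional using (Unique)
import Data.List.Relation.Unary.Unique.Propositional.Properties as Unique
open import Data.Nat
  using (ℕ; zero; suc; pred; _+_; _*_; _∸_; _^_; _≤_; _≤′_; ≤′-refl; ≤′-step; _<_; _≥_; _/_; _%_;
         NonZero; z≤n; s≤s; _≤?_; _≟_)
open import Data.Nat.Properties
open import Data.Nat.DivMod
open import Data.Nat.Divisibility using (n∣m*n)
open import Data.Nat.Induction using (<-rec; <-wellFounded)
open import Data.Nat.ListAction using (sum)
open import Data.Nat.ListAction.Properties using (sum-++)
open import Data.Nat.Tactic.RingSolver using (solve-∀)
open import Data.List.Membership.DecPropositional _≟_ using (_∈?_)
open import Algebra.Properties.CommutativeSemigroup *-commutativeSemigroup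
  using (x∙yz≈y∙xz; xy∙z≈y∙xz)
open import Data.Product using (_×_; _,_; proj₁; proj₂; ∃-syntax)
open import Data.Sum using (inj₁; inj₂)
open import Function using (_∘_)
open import Induction.WellFounded using (module FixPoint)
open import Relation.Binary.PropositionalEquality
open import Relation.Nullary using (¬_; Dec; yes; no)
open import Relation.Unary using (Decidable; _∩_; ∁)
open import Relation.Unary.Properties using (∁?)

-- Counting distinct elements

AtMost : {A : Set} → ℕ → (A → Set) → Set
AtMost {A} X P = (L : List A) → Unique L → All P L → length L ≤ X

length-filter-∁ : {A : Set} {P : A → Set} (P? : Decidable P) (xs : List A) →
                  length xs ≡ length (filter P? xs) + length (filter (∁? P?) xs)
length-filter-∁ P? []       = refl
length-filter-∁ P? (x ∷ xs) with P? x
... | yes _ = cong suc (length-filter-∁ P? xs)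
... | no  _ = trans (cong suc (length-filter-∁ P? xs)) (sym (+-suc _ _))

module _ {A B : Set} {P : A → Set} (f : A → B) where

  Unique-map⁺ : (∀ {x y} → P x → P y → f x ≡ f y → x ≡ y) →
                ∀ {xs} → All P xs → Unique xs → Unique (map f xs)
  Unique-map⁺ inj []         []           = []
  Unique-map⁺ inj (px ∷ pxs) (x∉xs ∷ uxs) =
    All.map⁺ (All.zipWith (λ (py , x≢y) fx≡fy → x≢y (inj px py fx≡fy)) (pxs , x∉xs))
      ∷ Unique-map⁺ inj pxs uxs

module _ {A : Set} {P : A → Set} where

  AtMost-weaken : ∀ {X Y} → X ≤ Y → AtMost X P → AtMost Y P
  AtMost-weaken X≤Y atMost L u pL = ≤-trans (atMost L u pL) X≤Y

  AtMost-empty : (∀ {x} → ¬ P x) → AtMost 0 P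
  AtMost-empty ¬P []      _ _        = z≤n
  AtMost-empty ¬P (_ ∷ _) _ (px ∷ _) = ⊥-elim (¬P px)

  AtMost-subsingleton : (∀ {x y} → P x → P y → x ≡ y) → AtMost 1 P
  AtMost-subsingleton _  []          _               _             = z≤n
  AtMost-subsingleton _  (_ ∷ [])    _               _             = s≤s z≤n
  AtMost-subsingleton eq (_ ∷ _ ∷ _) ((x≢y ∷ _) ∷ _) (px ∷ py ∷ _) = ⊥-elim (x≢y (eq px py))

  AtMost-split : ∀ {R : A → Set} {X Y} → Decidable R →
                 AtMost X (P ∩ R) → AtMost Y (P ∩ ∁ R) → AtMost (X + Y) P
  AtMost-split {X = X} {Y} R? atMostR atMost∁R L u pL = begin
    length L                                          ≡⟨ length-filter-∁ R? L ⟩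
    length (filter R? L) + length (filter (∁? R?) L) ≤⟨ +-mono-≤ (restrict R? atMostR)
                                                                  (restrict (∁? R?) atMost∁R) ⟩
    X + Y                                             ∎
    where
    open ≤-Reasoning
    restrict : ∀ {S Z} (S? : Decidable S) → AtMost Z (P ∩ S) → length (filter S? L) ≤ Z
    restrict S? atMostS =
      atMostS _ (Unique.filter⁺ S? u) (All.zip (All.filter⁺ S? pL , All.all-filter S? L))

  AtMost-map : ∀ {B : Set} {Q : B → Set} {X} (f : A → B) (g : B → A) →
               (∀ {x} → P x → Q (f x)) → (∀ {x} → P x → g (f x) ≡ x) →
               AtMost X Q → AtMost X P
  AtMost-map f g P⇒Q g∘f≡id atMost L u pL =
    subst (_≤ _) (length-map f L)
      (atMost (map f L) (Unique-map⁺ f inj pL u) (All.map⁺ (All.map P⇒Q pL)))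
    where
    inj : ∀ {x y} → P x → P y → f x ≡ f y → x ≡ y
    inj px py fx≡fy = trans (sym (g∘f≡id px)) (trans (cong g fx≡fy) (g∘f≡id py))

[r+q*d]%d≡r : ∀ {r} q d .{{_ : NonZero d}} → r < d → (r + q * d) % d ≡ r
[r+q*d]%d≡r q d r<d = trans ([m+kn]%n≡m%n _ q d) (m<n⇒m%n≡m r<d)

[r+q*d]/d≡q : ∀ {r} q d .{{_ : NonZero d}} → r < d → (r + q * d) / d ≡ q
[r+q*d]/d≡q {r} q d r<d =
  trans (+-distrib-/-∣ʳ r (n∣m*n q)) (cong₂ _+_ (m<n⇒m/n≡0 r<d) (m*n/n≡m q d))

dropLast : {A : Set} → List A → List A
dropLast []           = []
dropLast (_ ∷ [])     = []
dropLast (x ∷ y ∷ ys) = x ∷ dropLast (y ∷ ys)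

Linked-dropLast : ∀ {A : Set} {R : A → A → Set} {xs} → Linked R xs → Linked R (dropLast xs)
Linked-dropLast []                  = []
Linked-dropLast [-]                 = []
Linked-dropLast (_ ∷ [-])           = [-]
Linked-dropLast (Rxy ∷ Ryz ∷ links) = Rxy ∷ Linked-dropLast (Ryz ∷ links)

dropLast-∷ʳ-min : ∀ {a p} → Linked _≥_ p → All (a ≤_) p → a ∈ p → dropLast p ∷ʳ a ≡ p
dropLast-∷ʳ-min {p = _ ∷ []}     _            _             (here refl) = refl
dropLast-∷ʳ-min {p = x ∷ y ∷ ys} (y≤x ∷ links) (_ ∷ a≤y∷ys) a∈p         =
  cong (x ∷_) (dropLast-∷ʳ-min links a≤y∷ys (a∈tail a∈p))
  where
  a∈tail : _ ∈ x ∷ y ∷ ys → _ ∈ y ∷ ys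
  a∈tail (here refl) = here (≤-antisym (All.head a≤y∷ys) y≤x)
  a∈tail (there a∈)  = a∈

module _ (b : ℕ) .{{_ : NonZero b}} where

  IsPowerOf-pos : ∀ {x} → IsPowerOf b x → 1 ≤ x
  IsPowerOf-pos (j , refl) = m^n>0 b j

  IsPowerOf-/ : ∀ {x} → IsPowerOf b x → x ≢ 1 → IsPowerOf b (x / b) × x / b * b ≡ x
  IsPowerOf-/ (zero  , refl) x≢1 = ⊥-elim (x≢1 refl)
  IsPowerOf-/ (suc j , refl) _   = (j , b^j≡) , trans (cong (_* b) b^j≡) (*-comm (b ^ j) b)
    where
    b^j≡ : b ^ suc j / b ≡ b ^ j
    b^j≡ = trans (cong (_/ b) (*-comm b (b ^ j))) (m*n/n≡m (b ^ j) b)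

  sum-map-/* : ∀ {p} → All (λ x → x / b * b ≡ x) p → sum (map (_/ b) p) * b ≡ sum p
  sum-map-/* []                        = refl
  sum-map-/* {x ∷ xs} (x/b*b≡x ∷ rest) =
    trans (*-distribʳ-+ b (x / b) (sum (map (_/ b) xs))) (cong₂ _+_ x/b*b≡x (sum-map-/* rest))

prodTerms-suc : ∀ d c r → prodTerms d c (suc r) ≡ c * prodTerms d (c ∸ d) r
prodTerms-suc d c zero    = trans (+-identityʳ c) (sym (*-identityʳ c))
prodTerms-suc d c (suc r) = begin
  prodTerms d c (suc r) * (c ∸ suc r * d)
    ≡⟨ cong₂ _*_ (prodTerms-suc d c r) (sym (∸-+-assoc c d (r * d))) ⟩
  c * prodTerms d (c ∸ d) r * (c ∸ d ∸ r * d)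
    ≡⟨ *-assoc c _ _ ⟩
  c * (prodTerms d (c ∸ d) r * (c ∸ d ∸ r * d))
    ∎
  where open ≡-Reasoning

-- The base is m = t + 2, so that m and m ∸ 1 = suc t carry NonZero instances automatically.
module _ (t : ℕ) where

  private
    m : ℕ
    m = suc (suc t)

  -- Base-m residues and digit sums

  suc≡*m : ∀ n → suc n % m ≡ 0 → suc n ≡ suc (n / m) * m
  suc≡*m n sn%m≡0 =
    cong suc (trans (m≡m%n+[m/n]*n n m) (cong (_+ n / m * m) (%-pred-≡0 {n} sn%m≡0)))

  suc/m≡ : ∀ n → suc n % m ≡ 0 → suc n / m ≡ suc (n / m)
  suc/m≡ n sn%m≡0 = trans (cong (_/ m) (suc≡*m n sn%m≡0)) (m*n/n≡m (suc (n / m)) m)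

  %-suc : ∀ n → suc n % m ≢ 0 → suc n % m ≡ suc (n % m)
  %-suc n sn%m≢0 with m≤n⇒m<n∨m≡n (m%n<n n m)
  ... | inj₁ 1+n%m<m = trans (%-distribˡ-+ 1 n m) (m<n⇒m%n≡m 1+n%m<m)
  ... | inj₂ 1+n%m≡m =
    ⊥-elim (sn%m≢0 (trans (%-distribˡ-+ 1 n m) (trans (cong (_% m) 1+n%m≡m) (n%n≡0 m))))

  private
    digitSum-step : ∀ n → (∀ {y} → y < n → ℕ) → ℕ
    digitSum-step zero    _   = 0
    digitSum-step (suc n) rec = suc n % m + rec (m/n<m (suc n) m (s≤s (s≤s z≤n)))

    digitSum-step-ext : ∀ n {rec rec′ : ∀ {y} → y < n → ℕ} →
                        (∀ {y} (y<n : y < n) → rec y<n ≡ rec′ y<n) →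
                        digitSum-step n rec ≡ digitSum-step n rec′
    digitSum-step-ext zero    _        = refl
    digitSum-step-ext (suc n) rec≡rec′ = cong (suc n % m +_) (rec≡rec′ _)

  digitSum : ℕ → ℕ
  digitSum = <-rec _ digitSum-step

  private
    module DigitSum = FixPoint <-wellFounded _ digitSum-step digitSum-step-ext

  digitSum-zero : digitSum 0 ≡ 0
  digitSum-zero = DigitSum.unfold-wfRec {0}

  digitSum-unfold : ∀ n → digitSum n ≡ n % m + digitSum (n / m)
  digitSum-unfold zero    = refl
  digitSum-unfold (suc n) = DigitSum.unfold-wfRec {suc n}

  digitSum-digit : ∀ {r} q → r < m → digitSum (r + q * m) ≡ r + digitSum q
  digitSum-digit {r} q r<m = begin
    digitSum (r + q * m)                         ≡⟨ digitSum-unfold (r + q * m) ⟩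
    (r + q * m) % m + digitSum ((r + q * m) / m) ≡⟨ cong₂ (λ a b → a + digitSum b)
                                                           ([r+q*d]%d≡r q m r<m) ([r+q*d]/d≡q q m r<m) ⟩
    r + digitSum q                               ∎
    where open ≡-Reasoning

  %≤digitSum : ∀ n → n % m ≤ digitSum n
  %≤digitSum n = subst (n % m ≤_) (sym (digitSum-unfold n)) (m≤m+n _ _)

  digitSum-pred-multiple : ∀ n → suc n % m ≡ 0 → digitSum n ≡ m ∸ 1 + digitSum (n / m)
  digitSum-pred-multiple n sn%m≡0 =
    trans (digitSum-unfold n) (cong (_+ digitSum (n / m)) (%-pred-≡0 {n} sn%m≡0))

  digitSum-suc : ∀ a → digitSum (suc a) ≤ suc (digitSum a)
  digitSum-suc = <-rec _ step
    where
    step : ∀ a → (∀ {b} → b < a → digitSum (suc b) ≤ suc (digitSum b)) →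
           digitSum (suc a) ≤ suc (digitSum a)
    step a rec = subst (λ x → digitSum (suc x) ≤ suc (digitSum x)) (sym a≡)
                   (carry (a % m) (m%n<n a m) a≡)
      where
      q : ℕ
      q = a / m
      a≡ : a ≡ a % m + q * m
      a≡ = m≡m%n+[m/n]*n a m
      carry : ∀ r → r < m → a ≡ r + q * m →
              digitSum (suc (r + q * m)) ≤ suc (digitSum (r + q * m))
      carry r (s≤s r≤m∸1) a≡r+qm with m≤n⇒m<n∨m≡n r≤m∸1
      ... | inj₁ r<m∸1 =
        ≤-reflexive (trans (digitSum-digit q (s≤s r<m∸1))
                           (cong suc (sym (digitSum-digit q (s≤s r≤m∸1)))))
      ... | inj₂ refl = begin
        digitSum (suc q * m)          ≡⟨ digitSum-digit (suc q) (s≤s z≤n) ⟩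
        digitSum (suc q)              ≤⟨ rec q<a ⟩
        suc (digitSum q)              ≤⟨ s≤s (m≤n+m _ (m ∸ 1)) ⟩
        suc (m ∸ 1 + digitSum q)      ≡⟨ cong suc (digitSum-digit q ≤-refl) ⟨
        suc (digitSum (m ∸ 1 + q * m)) ∎
        where
        open ≤-Reasoning
        q<a : q < a
        q<a = subst (q <_) (sym a≡r+qm) (s≤s (≤-trans (m≤m*n q m) (m≤n+m (q * m) t)))

  digitSum-pow-+ : ∀ j a → digitSum (m ^ j + a) ≤ suc (digitSum a)
  digitSum-pow-+ zero    a = digitSum-suc a
  digitSum-pow-+ (suc j) a = begin
    digitSum (m ^ suc j + a)       ≡⟨ cong (λ x → digitSum (m ^ suc j + x)) a≡ ⟩
    digitSum (m ^ suc j + (r + q * m)) ≡⟨ cong digitSum (shift m (m ^ j) r q) ⟩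
    digitSum (r + (m ^ j + q) * m) ≡⟨ digitSum-digit (m ^ j + q) (m%n<n a m) ⟩
    r + digitSum (m ^ j + q)       ≤⟨ +-monoʳ-≤ r (digitSum-pow-+ j q) ⟩
    r + suc (digitSum q)           ≡⟨ +-suc r _ ⟩
    suc (r + digitSum q)           ≡⟨ cong suc (digitSum-digit q (m%n<n a m)) ⟨
    suc (digitSum (r + q * m))     ≡⟨ cong (suc ∘ digitSum) a≡ ⟨
    suc (digitSum a)               ∎
    where
    open ≤-Reasoning
    r q : ℕ
    r = a % m
    q = a / m
    a≡ : a ≡ r + q * m
    a≡ = m≡m%n+[m/n]*n a m
    shift : ∀ m x r q → m * x + (r + q * m) ≡ r + (x + q) * m
    shift = solve-∀

  digitSum-sum≤length : ∀ {ps} → All (IsPowerOf m) ps → digitSum (sum ps) ≤ length ps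
  digitSum-sum≤length []                = ≤-reflexive digitSum-zero
  digitSum-sum≤length ((j , refl) ∷ ps) =
    ≤-trans (digitSum-pow-+ j _) (s≤s (digitSum-sum≤length ps))

  -- The bounding function

  private
    bound-step : ∀ x → (∀ {y} → y < x → ℕ) → ℕ
    bound-step zero    _   = 1
    bound-step (suc x) rec = rec ≤-refl + x / (m ∸ 1) * rec (s≤s (m∸n≤m x (m ∸ 1)))

    bound-step-ext : ∀ x {rec rec′ : ∀ {y} → y < x → ℕ} →
                     (∀ {y} (y<x : y < x) → rec y<x ≡ rec′ y<x) →
                     bound-step x rec ≡ bound-step x rec′
    bound-step-ext zero    _        = refl
    bound-step-ext (suc x) rec≡rec′ =
      cong₂ (λ a b → a + x / (m ∸ 1) * b) (rec≡rec′ _) (rec≡rec′ _)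

  bound : ℕ → ℕ
  bound = <-rec _ bound-step

  private
    module Bound = FixPoint <-wellFounded _ bound-step bound-step-ext

  bound-zero : bound 0 ≡ 1
  bound-zero = Bound.unfold-wfRec {0}

  bound-suc : ∀ x → bound (suc x) ≡ bound x + x / (m ∸ 1) * bound (suc x ∸ m)
  bound-suc x = Bound.unfold-wfRec {suc x}

  bound-≤-suc : ∀ x → bound x ≤ bound (suc x)
  bound-≤-suc x = subst (bound x ≤_) (sym (bound-suc x)) (m≤m+n _ _)

  bound-mono : ∀ {x y} → x ≤ y → bound x ≤ bound y
  bound-mono = mono′ ∘ ≤⇒≤′
    where
    mono′ : ∀ {x y} → x ≤′ y → bound x ≤ bound y
    mono′             ≤′-refl        = ≤-refl
    mono′ {y = suc y} (≤′-step x≤′y) = ≤-trans (mono′ x≤′y) (bound-≤-suc y)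

  bound-pos : ∀ x → 1 ≤ bound x
  bound-pos x = subst (_≤ bound x) bound-zero (bound-mono {0} {x} z≤n)

  bound-small : ∀ {x} → x < m → bound x ≡ 1
  bound-small {zero}  _             = bound-zero
  bound-small {suc x} (s≤s x<m∸1) =
    trans (bound-suc x) (cong₂ (λ a b → a + b * bound (suc x ∸ m))
                               (bound-small (m<n⇒m<1+n x<m∸1)) (m<n⇒m/n≡0 x<m∸1))

  bound-extend : ∀ {k c} → c * (m ∸ 1) ≤ k → bound k + c * bound (suc k ∸ m) ≤ bound (suc k)
  bound-extend {k} {c} c*[m∸1]≤k =
    subst (bound k + c * bound (suc k ∸ m) ≤_) (sym (bound-suc k))
      (+-monoʳ-≤ (bound k) (*-monoˡ-≤ _ c≤))
    where
    c≤ : c ≤ k / (m ∸ 1)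
    c≤ = subst (_≤ k / (m ∸ 1)) (m*n/n≡m c (m ∸ 1)) (/-monoˡ-≤ (m ∸ 1) c*[m∸1]≤k)

  bound-suc-≤ : ∀ x → (m ∸ 1) * bound (suc x) ≤ (m ∸ 1) * bound x + x * bound (suc x ∸ m)
  bound-suc-≤ x = begin
    (m ∸ 1) * bound (suc x)                         ≡⟨ cong ((m ∸ 1) *_) (bound-suc x) ⟩
    (m ∸ 1) * (bound x + x / (m ∸ 1) * b)           ≡⟨ *-distribˡ-+ (m ∸ 1) (bound x) _ ⟩
    (m ∸ 1) * bound x + (m ∸ 1) * (x / (m ∸ 1) * b) ≡⟨ cong ((m ∸ 1) * bound x +_)
                                                            (*-assoc (m ∸ 1) (x / (m ∸ 1)) b) ⟨
    (m ∸ 1) * bound x + (m ∸ 1) * (x / (m ∸ 1)) * b ≤⟨ +-monoʳ-≤ _ (*-monoˡ-≤ b [m∸1]*[x/[m∸1]]≤x) ⟩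
    (m ∸ 1) * bound x + x * b                       ∎
    where
    open ≤-Reasoning
    b : ℕ
    b = bound (suc x ∸ m)
    [m∸1]*[x/[m∸1]]≤x : (m ∸ 1) * (x / (m ∸ 1)) ≤ x
    [m∸1]*[x/[m∸1]]≤x = ≤-trans (≤-reflexive (*-comm (m ∸ 1) _)) (m/n*n≤m x (m ∸ 1))

  bound-+-≤ : ∀ z j → j ≤ m → (m ∸ 1) * bound (z + j) ≤ ((m ∸ 1) + j * (z + (m ∸ 1))) * bound z
  bound-+-≤ z zero    _     =
    ≤-reflexive (cong₂ _*_ (sym (+-identityʳ (m ∸ 1))) (cong bound (+-identityʳ z)))
  bound-+-≤ z (suc j) 1+j≤m = begin
    (m ∸ 1) * bound (z + suc j)
      ≡⟨ cong (λ y → (m ∸ 1) * bound y) (+-suc z j) ⟩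
    (m ∸ 1) * bound (suc (z + j))
      ≤⟨ bound-suc-≤ (z + j) ⟩
    (m ∸ 1) * bound (z + j) + (z + j) * bound (suc (z + j) ∸ m)
      ≤⟨ +-mono-≤ (bound-+-≤ z j (<⇒≤ 1+j≤m)) (*-mono-≤ (+-monoʳ-≤ z j≤m∸1) (bound-mono lower)) ⟩
    ((m ∸ 1) + j * (z + (m ∸ 1))) * bound z + (z + (m ∸ 1)) * bound z
      ≡⟨ collect (m ∸ 1) j (z + (m ∸ 1)) (bound z) ⟩
    ((m ∸ 1) + suc j * (z + (m ∸ 1))) * bound z
      ∎
    where
    open ≤-Reasoning
    j≤m∸1 : j ≤ m ∸ 1
    j≤m∸1 = ≤-pred 1+j≤m
    lower : suc (z + j) ∸ m ≤ z
    lower = ≤-trans (∸-monoˡ-≤ (m ∸ 1) (+-monoʳ-≤ z j≤m∸1)) (≤-reflexive (m+n∸n≡m z (m ∸ 1)))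
    collect : ∀ a j w b → (a + j * w) * b + w * b ≡ (a + suc j * w) * b
    collect = solve-∀

  bound-+m : ∀ z → (m ∸ 1) * bound (z + m) ≤ m * (z + m) * bound z
  bound-+m z = ≤-trans (bound-+-≤ z m ≤-refl)
    (*-monoˡ-≤ (bound z) (≤-trans (+-monoˡ-≤ _ (n≤1+n (m ∸ 1))) (≤-reflexive (collect t z))))
    where
    collect : ∀ t z → suc (suc t) + suc (suc t) * (z + suc t) ≡ suc (suc t) * (z + suc (suc t))
    collect = solve-∀

  bound≤prodTerms : ∀ r {K} → K / m ≡ r → (m ∸ 1) ^ r * bound K ≤ m ^ r * prodTerms m K r
  bound≤prodTerms zero    {K} K/m≡0   =
    ≤-reflexive (cong (_+ 0) (bound-small {K} (m/n≡0⇒m<n K/m≡0)))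
  bound≤prodTerms (suc r) {K} K/m≡1+r = begin
    (m ∸ 1) ^ suc r * bound K                   ≡⟨ cong (λ y → (m ∸ 1) ^ suc r * bound y) K≡ ⟩
    (m ∸ 1) * (m ∸ 1) ^ r * bound (z + m)       ≡⟨ xy∙z≈y∙xz (m ∸ 1) ((m ∸ 1) ^ r) (bound (z + m)) ⟩
    (m ∸ 1) ^ r * ((m ∸ 1) * bound (z + m))     ≤⟨ *-monoʳ-≤ ((m ∸ 1) ^ r) (bound-+m z) ⟩
    (m ∸ 1) ^ r * (m * (z + m) * bound z)       ≡⟨ x∙yz≈y∙xz (m * (z + m)) ((m ∸ 1) ^ r) (bound z) ⟨
    m * (z + m) * ((m ∸ 1) ^ r * bound z)       ≤⟨ *-monoʳ-≤ (m * (z + m)) (bound≤prodTerms r z/m≡r) ⟩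
    m * (z + m) * (m ^ r * prodTerms m z r)     ≡⟨ [m*n]*[o*p]≡[m*o]*[n*p] m (z + m) (m ^ r) _ ⟩
    m ^ suc r * ((z + m) * prodTerms m z r)     ≡⟨ cong (λ y → m ^ suc r * (y * prodTerms m z r)) K≡ ⟨
    m ^ suc r * (K * prodTerms m (K ∸ m) r)     ≡⟨ cong (m ^ suc r *_) (prodTerms-suc m K r) ⟨
    m ^ suc r * prodTerms m K (suc r)           ∎
    where
    open ≤-Reasoning
    z : ℕ
    z = K ∸ m
    K≡ : K ≡ z + m
    K≡ = sym (m∸n+n≡m (m/n≢0⇒n≤m (λ K/m≡0 → 0≢1+n (trans (sym K/m≡0) K/m≡1+r))))
    z/m≡r : z / m ≡ r
    z/m≡r = trans ([m∸n]/n≡m/n∸1 K m) (cong pred K/m≡1+r)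

  -- Partitions into powers of m

  Partition : ℕ → ℕ → List ℕ → Set
  Partition = IsPowPartition m

  Partition⇒digitSum≤ : ∀ {k n p} → Partition k n p → digitSum n ≤ k
  Partition⇒digitSum≤ (_ , pow , refl , refl) = digitSum-sum≤length pow

  Partition-0-parts : ∀ {n p} → Partition 0 n p → p ≡ []
  Partition-0-parts {p = []} _ = refl

  Partition-of-0 : ∀ {k p} → Partition k 0 p → p ≡ []
  Partition-of-0 {p = []}    _                      = refl
  Partition-of-0 {p = x ∷ _} (_ , x-pow ∷ _ , _ , sum≡0) =
    ⊥-elim (<⇒≢ (IsPowerOf-pos m x-pow) (sym (m+n≡0⇒m≡0 x sum≡0)))

  Partition-dropLast : ∀ {k n p} → Partition (suc k) (suc n) p → 1 ∈ p →
                       Partition k n (dropLast p)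
  Partition-dropLast {k} {n} {p} (links , pow , len , sum≡) 1∈p =
    Linked-dropLast links , All.++⁻ˡ q (subst (All _) (sym q∷ʳ1≡p) pow) , len′ , sum′
    where
    q : List ℕ
    q = dropLast p
    q∷ʳ1≡p : q ∷ʳ 1 ≡ p
    q∷ʳ1≡p = dropLast-∷ʳ-min links (All.map (IsPowerOf-pos m) pow) 1∈p
    len′ : length q ≡ k
    len′ = suc-injective (trans (+-comm 1 (length q))
                                (trans (sym (length-++ q)) (trans (cong length q∷ʳ1≡p) len)))
    sum′ : sum q ≡ n
    sum′ = suc-injective (trans (+-comm 1 (sum q))
                                (trans (sym (sum-++ q (1 ∷ []))) (trans (cong sum q∷ʳ1≡p) sum≡)))

  Partition-multiples : ∀ {k n p} → Partition k n p → 1 ∉ p →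
                        All (λ x → IsPowerOf m (x / m) × x / m * m ≡ x) p
  Partition-multiples {p = p} (_ , pow , _) 1∉p =
    All.zipWith (λ (x-pow , x≢1) → IsPowerOf-/ m x-pow (x≢1 ∘ sym))
                (pow , All.¬Any⇒All¬ p 1∉p)

  Partition-sum-map-/ : ∀ {k n p} → Partition k n p → 1 ∉ p → sum (map (_/ m) p) * m ≡ n
  Partition-sum-map-/ part@(_ , _ , _ , sum≡) 1∉p =
    trans (sum-map-/* m (All.map proj₂ (Partition-multiples part 1∉p))) sum≡

  Partition-map-/ : ∀ {k n p} → Partition k n p → 1 ∉ p → Partition k (n / m) (map (_/ m) p)
  Partition-map-/ {p = p} part@(links , _ , len , _) 1∉p =
    Linked.map⁺ (Linked.map (/-monoˡ-≤ m) links) ,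
    All.map⁺ (All.map proj₁ (Partition-multiples part 1∉p)) ,
    trans (length-map _ p) len ,
    trans (sym (m*n/n≡m _ m)) (cong (_/ m) (Partition-sum-map-/ part 1∉p))

  Partition-map-/-retract : ∀ {k n p} → Partition k n p → 1 ∉ p →
                            map (_* m) (map (_/ m) p) ≡ p
  Partition-map-/-retract {p = p} part 1∉p =
    trans (sym (map-∘ p)) (map-id-local (All.map proj₂ (Partition-multiples part 1∉p)))

  Partition-%≡0 : ∀ {k n p} → Partition k n p → 1 ∉ p → n % m ≡ 0
  Partition-%≡0 {p = p} part 1∉p =
    trans (cong (_% m) (sym (Partition-sum-map-/ part 1∉p))) (m*n%n≡0 (sum (map (_/ m) p)) m)

  count-0-parts : ∀ {n} → AtMost 1 (Partition 0 n)
  count-0-parts =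
    AtMost-subsingleton λ p q → trans (Partition-0-parts p) (sym (Partition-0-parts q))

  count-of-0 : ∀ {k} → AtMost 1 (Partition k 0)
  count-of-0 = AtMost-subsingleton λ p q → trans (Partition-of-0 p) (sym (Partition-of-0 q))

  count-below-digitSum : ∀ {k n} → k < digitSum n → AtMost 0 (Partition k n)
  count-below-digitSum k<ds = AtMost-empty (λ part → <⇒≱ k<ds (Partition⇒digitSum≤ part))

  count-below-residue : ∀ {k n} → k < n % m → AtMost 0 (Partition k n)
  count-below-residue {n = n} k<n%m = count-below-digitSum (<-≤-trans k<n%m (%≤digitSum n))

  count-with-one : ∀ {X k n} → AtMost X (Partition k n) →
                   AtMost X (Partition (suc k) (suc n) ∩ (1 ∈_))
  count-with-one = AtMost-map dropLast (_∷ʳ 1)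
    (λ (part , 1∈p) → Partition-dropLast part 1∈p)
    (λ ((links , pow , _) , 1∈p) → dropLast-∷ʳ-min links (All.map (IsPowerOf-pos m) pow) 1∈p)

  count-without-one : ∀ {X k n} → AtMost X (Partition k (n / m)) →
                      AtMost X (Partition k n ∩ ∁ (1 ∈_))
  count-without-one = AtMost-map (map (_/ m)) (map (_* m))
    (λ (part , 1∉p) → Partition-map-/ part 1∉p)
    (λ (part , 1∉p) → Partition-map-/-retract part 1∉p)

  count-divisible : ∀ {X Y k n} → suc n % m ≡ 0 →
                    AtMost X (Partition k n) → AtMost Y (Partition (suc k) (suc (n / m))) →
                    AtMost (X + Y) (Partition (suc k) (suc n))
  count-divisible {Y = Y} {k} {n} sn%m≡0 atMostX atMostY =
    AtMost-split (1 ∈?_) (count-with-one atMostX)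
      (count-without-one
        (subst (λ N → AtMost Y (Partition (suc k) N)) (sym (suc/m≡ n sn%m≡0)) atMostY))

  count-indivisible : ∀ {X k n} → suc n % m ≢ 0 →
                      AtMost X (Partition k n) → AtMost X (Partition (suc k) (suc n))
  count-indivisible {X} sn%m≢0 atMostX =
    AtMost-weaken (≤-reflexive (+-identityʳ X))
      (AtMost-split (1 ∈?_) (count-with-one atMostX)
        (AtMost-empty (λ (part , 1∉p) → sn%m≢0 (Partition-%≡0 part 1∉p))))

  Bounded : ℕ → Set
  Bounded n = ∀ k → AtMost (bound (k ∸ n % m)) (Partition k n)

  -- c counts the surviving levels n/mʲ of the unfolding; each adds m − 1 to the digit sum of n − 1.
  ChainBound : ℕ → ℕ → ℕ → Set
  ChainBound k d n = ∃[ c ] c * (m ∸ 1) ≤ k × c * (m ∸ 1) ≤ d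
                          × AtMost (bound k + c * bound (suc k ∸ m)) (Partition (suc k) n)

  ChainBounded : ℕ → Set
  ChainBounded n = n % m ≡ 0 → ∀ k → ChainBound k (digitSum (pred n)) n

  chainBound-indivisible : ∀ {k d n} → n % m ≢ 0 → Bounded n → ChainBound k d n
  chainBound-indivisible {k} {n = n} n%m≢0 bounded-n =
    0 , z≤n , z≤n ,
    AtMost-weaken (≤-trans (bound-mono (suc∸≤ (n % m) n%m≢0)) (m≤m+n _ 0)) (bounded-n (suc k))
    where
    suc∸≤ : ∀ r → r ≢ 0 → suc k ∸ r ≤ k
    suc∸≤ zero    r≢0 = ⊥-elim (r≢0 refl)
    suc∸≤ (suc r) _   = m∸n≤m k r

  chainBound-extend : ∀ {k n} → suc n % m ≡ 0 → AtMost (bound (suc k ∸ m)) (Partition k n) →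
                      ChainBound k (digitSum (n / m)) (suc (n / m)) → ChainBound k (digitSum n) (suc n)
  chainBound-extend {k} {n} sn%m≡0 withOne (c , c≤k , c≤ , withoutOne) with digitSum n ≤? k
  ... | yes digitSum≤k =
    suc c , ≤-trans 1+c≤ digitSum≤k , 1+c≤ ,
    AtMost-weaken (≤-reflexive (collect (bound (suc k ∸ m)) (bound k) c))
      (count-divisible sn%m≡0 withOne withoutOne)
    where
    1+c≤ : suc c * (m ∸ 1) ≤ digitSum n
    1+c≤ = ≤-trans (+-monoʳ-≤ (m ∸ 1) c≤) (≤-reflexive (sym (digitSum-pred-multiple n sn%m≡0)))
    collect : ∀ a b c → a + (b + c * a) ≡ b + suc c * a
    collect = solve-∀
  ... | no digitSum≰k =
    c , c≤k ,
    ≤-trans c≤ (subst (digitSum (n / m) ≤_) (sym (digitSum-pred-multiple n sn%m≡0)) (m≤n+m _ _)) ,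
    count-divisible sn%m≡0 (count-below-digitSum (≰⇒> digitSum≰k)) withoutOne

  chainBounded-step : ∀ n → (∀ {y} → y < n → Bounded y × ChainBounded y) → ChainBounded n
  chainBounded-step zero    _   _       k =
    0 , z≤n , z≤n , AtMost-weaken (≤-trans (bound-pos k) (m≤m+n _ 0)) count-of-0
  chainBounded-step (suc n) rec sn%m≡0 k =
    chainBound-extend sn%m≡0 withOne (withoutOne (suc q % m ≟ 0))
    where
    q : ℕ
    q = n / m
    1+q<1+n : suc q < suc n
    1+q<1+n = subst (suc q <_) (sym (suc≡*m n sn%m≡0)) (m<m*n (suc q) m (s≤s (s≤s z≤n)))
    withOne : AtMost (bound (suc k ∸ m)) (Partition k n)
    withOne = subst (λ r → AtMost (bound (k ∸ r)) (Partition k n)) (%-pred-≡0 {n} sn%m≡0)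
                    (proj₁ (rec ≤-refl) k)
    withoutOne : Dec (suc q % m ≡ 0) → ChainBound k (digitSum q) (suc q)
    withoutOne (yes 1+q%m≡0) = proj₂ (rec 1+q<1+n) 1+q%m≡0 k
    withoutOne (no 1+q%m≢0)  = chainBound-indivisible 1+q%m≢0 (proj₁ (rec 1+q<1+n))

  bounded-step : ∀ n → (∀ {y} → y < n → Bounded y × ChainBounded y) → ChainBounded n → Bounded n
  bounded-step zero    _   _     k       = AtMost-weaken (bound-pos (k ∸ 0 % m)) count-of-0
  bounded-step (suc n) _   _     zero    = AtMost-weaken (bound-pos (0 ∸ suc n % m)) count-0-parts
  bounded-step (suc n) rec chain (suc k) with suc n % m ≟ 0
  ... | yes sn%m≡0 =
    let c , c*[m∸1]≤k , _ , atMost = chain sn%m≡0 k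
    in  subst (λ r → AtMost (bound (suc k ∸ r)) (Partition (suc k) (suc n))) (sym sn%m≡0)
          (AtMost-weaken (bound-extend {k} {c} c*[m∸1]≤k) atMost)
  ... | no sn%m≢0  =
    subst (λ r → AtMost (bound (suc k ∸ r)) (Partition (suc k) (suc n))) (sym (%-suc n sn%m≢0))
      (count-indivisible sn%m≢0 (proj₁ (rec ≤-refl) k))

  bounded : ∀ n → Bounded n
  bounded n = proj₁ (<-rec (λ n → Bounded n × ChainBounded n) step n)
    where
    step : ∀ n → (∀ {y} → y < n → Bounded y × ChainBounded y) → Bounded n × ChainBounded n
    step n rec = bounded-step n rec (chainBounded-step n rec) , chainBounded-step n rec

theorem6p3 : (m k : ℕ) → 2 ≤ m → .{{_ : NonZero m}} →
    ((n : ℕ) → (L : List (List ℕ)) → Unique L → All (IsPowPartition m k n) L →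
      (k < n % m → length L * m ≤ m ∸ 1)
      × (n % m ≤ k →
          length L * (m ∸ 1) ^ ((k ∸ n % m) / m)
            ≤ m ^ ((k ∸ n % m) / m) * prodTerms m (k ∸ n % m) ((k ∸ n % m) / m)))
    × (∃[ B ] ((n : ℕ) → (L : List (List ℕ)) → Unique L → All (IsPowPartition m k n) L →
         length L ≤ B))
theorem6p3 (suc zero)    k (s≤s ())
theorem6p3 (suc (suc t)) k _ =
  (λ n L u parts → noPartitions n L u parts , λ _ → closedForm n L u parts) ,
  bound t k ,
  λ n L u parts → ≤-trans (bounded t n k L u parts) (bound-mono t (m∸n≤m k (n % m)))
  where
  m : ℕ
  m = suc (suc t)
  noPartitions : ∀ n L → Unique L → All (IsPowPartition m k n) L →
                 k < n % m → length L * m ≤ m ∸ 1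
  noPartitions n L u parts k<n%m =
    ≤-trans (*-monoˡ-≤ m (count-below-residue t k<n%m L u parts)) z≤n
  closedForm : ∀ n L → Unique L → All (IsPowPartition m k n) L → let K = k ∸ n % m in
               length L * (m ∸ 1) ^ (K / m) ≤ m ^ (K / m) * prodTerms m K (K / m)
  closedForm n L u parts = begin
    length L * (m ∸ 1) ^ (K / m)  ≤⟨ *-monoˡ-≤ _ (bounded t n k L u parts) ⟩
    bound t K * (m ∸ 1) ^ (K / m) ≡⟨ *-comm (bound t K) _ ⟩
    (m ∸ 1) ^ (K / m) * bound t K ≤⟨ bound≤prodTerms t (K / m) refl ⟩
    m ^ (K / m) * prodTerms m K (K / m) ∎
    where
    open ≤-Reasoning
    K : ℕ
    K = k ∸ n % m
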